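{- For an integer $j\ge 0$, let $s_j(z)=\sum_{n\ge0} a_{n,j}z^n$, where $a_{n,j}$ is the number of partial decorated Dyck paths of length $n$ ending at height $j$ (defined in the context) that have no peak at level $1$. Define the formal power series \[ g_0=\frac{1-3z^2-2z^4-\sqrt{1-6z^2+5z^4}}{2z^2(z^2+3)}, \] and let $r_1=\dfrac{1+z^2+\sqrt{1-6z^2+5z^4}}{2z}$ (square roots having constant term $1$). Then \[ s_j(z)=\frac{z^4+z^4g_0+z^2g_0-z^2+1}{z\,r_1^{\,j+1}} =\frac{2^{j+1}z^j\,\bigl(1-z^2+z^4+(z^2+z^4)g_0\bigr)}{\bigl(1+z^2+\sqrt{1-6z^2+5z^4}\bigr)^{j+1}}. \]
   Context: A partial decorated Dyck path of length $n$ ending at height $j$ is a sequence of $n$ steps, each being an up-step $U=(1,1)$, a black down-step $D=(1,-1)$, or a red down-step $R=(1,-1)$, starting at $(0,0)$, never going below the $x$-axis, ending at $(n,j)$, such that an up-step is never immediately followed by a red down-step and a red down-step is never immediately followed by an up-step. (Red down-steps correspond to south-west steps of skew Dyck paths.) A peak at level $1$ is an up-step from height $0$ to height $1$ immediately followed by a down-step. The empty path is the unique path of length $0$ ending at height $0$. -}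

module Defs where

open import Data.Bool using (Bool; true; false; _∧_; if_then_else_)
open import Data.Nat as ℕ using (ℕ; zero; suc; _≡ᵇ_)
open import Data.Integer using (+_)
open import Data.List using (List; []; _∷_; _∷ʳ_; map; concatMap; length; filter; foldr; upTo)
open import Data.Rational as ℚ using (ℚ; 0ℚ; 1ℚ; ½; _/_; 1/_; ≢-nonZero)
open import Data.Rational.Properties using (_≟_)
open import Relation.Nullary using (yes; no; does)
open import Relation.Unary using (Decidable)
open import Relation.Binary.PropositionalEquality using (_≡_)

-- U = up-step (1,1), D = black down-step (1,-1), R = red down-step (1,-1)
data Step : Set where
  U D R : Step

words : ℕ → List (List Step)
words zero    = [] ∷ []
words (suc n) = concatMap (λ w → (U ∷ w) ∷ (D ∷ w) ∷ (R ∷ w) ∷ []) (words n)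

data Prev : Set where
  start pU pD pR : Prev

-- check h p w j : reading the remaining steps w from current height h,
-- with previous step p, the path never goes below the x-axis, U is never
-- immediately followed by R, R is never immediately followed by U,
-- there is no peak at level 1 (an up-step from height 0 to 1 immediately
-- followed by a down-step; this is detected as a down-step taken right
-- after an up-step at height 1), and the path ends at height j.
checkNP : ℕ → Prev → List Step → ℕ → Bool
checkNP h       p  []       j = h ≡ᵇ j
checkNP h       pR (U ∷ w)  j = false
checkNP h       p  (U ∷ w)  j = checkNP (suc h) pU w j
checkNP zero    p  (D ∷ w)  j = false
checkNP (suc h) pU (D ∷ w)  j = if h ≡ᵇ 0 then false else checkNP h pD w j
checkNP (suc h) p  (D ∷ w)  j = checkNP h pD w j
checkNP zero    p  (R ∷ w)  j = false
checkNP (suc h) pU (R ∷ w)  j = false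
checkNP (suc h) p  (R ∷ w)  j = checkNP h pR w j

a : ℕ → ℕ → ℕ
a n j = length (filter (λ w → checkNP 0 start w j Data.Bool.≟ true) (words n))
  where import Data.Bool

FPS : Set
FPS = ℕ → ℚ

qn : ℕ → ℚ
qn n = + n / 1

con : ℚ → FPS
con c zero    = c
con c (suc n) = 0ℚ

z : FPS
z 1 = 1ℚ
z _ = 0ℚ

infixl 6 _⊕_ _⊖_
infixl 7 _⊛_

_⊕_ : FPS → FPS → FPS
(f ⊕ g) n = f n ℚ.+ g n

_⊖_ : FPS → FPS → FPS
(f ⊖ g) n = f n ℚ.- g n

sumℚ : List ℚ → ℚ
sumℚ = foldr ℚ._+_ 0ℚ

_⊛_ : FPS → FPS → FPS
(f ⊛ g) n = sumℚ (map (λ k → f k ℚ.* g (n ℕ.∸ k)) (upTo (suc n)))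

pow : FPS → ℕ → FPS
pow f zero    = con 1ℚ
pow f (suc k) = f ⊛ pow f k

at : List ℚ → ℕ → ℚ
at []       _       = 0ℚ
at (x ∷ xs) zero    = x
at (x ∷ xs) (suc i) = at xs i

-- reciprocal of a series with nonzero constant term
-- (junk value 0 if the constant term is 0)
inv0 : ℚ → ℚ
inv0 c with c ≟ 0ℚ
... | yes _ = 0ℚ
... | no c≢0 = 1/_ c {{≢-nonZero c≢0}}

-- invList f n = [b₀, …, bₙ] where b = 1/f
invList : FPS → ℕ → List ℚ
invList f zero    = inv0 (f 0) ∷ []
invList f (suc n) = L ∷ʳ (ℚ.- (inv0 (f 0) ℚ.* s))
  where
  L = invList f n
  s = sumℚ (map (λ k → f (suc k) ℚ.* at L (n ℕ.∸ k)) (upTo (suc n)))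

inv : FPS → FPS
inv f n = at (invList f n) n

-- square root with constant term 1 of a series with constant term 1:
-- s₀ = 1, s_{n+1} = (f_{n+1} - Σ_{k=1}^{n} s_k s_{n+1-k}) / 2
sqrtList : FPS → ℕ → List ℚ
sqrtList f zero    = 1ℚ ∷ []
sqrtList f (suc n) = L ∷ʳ (½ ℚ.* (f (suc n) ℚ.- s))
  where
  L = sqrtList f n
  s = sumℚ (map (λ k → at L (suc k) ℚ.* at L (n ℕ.∸ k)) (upTo n))

sqrt1 : FPS → FPS
sqrt1 f n = at (sqrtList f n) n

-- division by z² (shift by two; exact when coefficients 0 and 1 vanish)
divZ2 : FPS → FPS
divZ2 f n = f (suc (suc n))

z² z⁴ : FPS
z² = pow z 2
z⁴ = pow z 4

Δ : FPS
Δ = sqrt1 (con 1ℚ ⊖ con (qn 6) ⊛ z² ⊕ con (qn 5) ⊛ z⁴)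

g₀ : FPS
g₀ = divZ2 (con 1ℚ ⊖ con (qn 3) ⊛ z² ⊖ con (qn 2) ⊛ z⁴ ⊖ Δ)
     ⊛ inv (con (qn 2) ⊛ (z² ⊕ con (qn 3)))

s : ℕ → FPS
s j n = qn (a n j)

rhs : ℕ → FPS
rhs j = con (qn (2 ℕ.^ suc j)) ⊛ pow z j
        ⊛ (con 1ℚ ⊖ z² ⊕ z⁴ ⊕ (z² ⊕ z⁴) ⊛ g₀)
        ⊛ inv (pow (con 1ℚ ⊕ z² ⊕ Δ) (suc j))

-- first form: (z⁴ + z⁴ g₀ + z² g₀ - z² + 1) / (z r₁^{j+1}),
-- with z r₁ = (1 + z² + Δ)/2, i.e. z r₁^{j+1} = (z r₁)^{j+1} / z^j
rhs₁ : ℕ → FPS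
rhs₁ j = pow z j ⊛ (z⁴ ⊕ z⁴ ⊛ g₀ ⊕ z² ⊛ g₀ ⊖ z² ⊕ con 1ℚ)
         ⊛ inv (pow (con ½ ⊛ (con 1ℚ ⊕ z² ⊕ Δ)) (suc j))

module Submission where

open import Defs
open import Algebra using (CommutativeRing)
open import Algebra.Structures using (IsCommutativeRing)
open import Algebra.Solver.Ring.AlmostCommutativeRing
  using (AlmostCommutativeRing; fromCommutativeRing; _-Raw-AlmostCommutative⟶_)
open import Data.Bool using (Bool; true; false; _∧_; if_then_else_)
import Data.Bool as Bool
open import Data.Empty using (⊥-elim)
open import Data.List using (List; []; _∷_; _∷ʳ_; _++_; length; map; foldl; foldr; filter; concatMap; applyUpTo; upTo)
import Data.List.Properties as List
open import Data.Maybe using (Maybe; just; nothing; maybe′)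
open import Data.Nat as ℕ using (ℕ; zero; suc; _∸_; _≤_; _<_; z≤n; s≤s; _≡ᵇ_)
import Data.Nat.Properties as ℕ
open import Data.Nat.ListAction using (sum)
open import Data.Nat.ListAction.Properties using (sum-++)
open import Data.Nat.Coprimality using (1-coprimeTo) renaming (sym to coprime-sym)
import Data.Integer as ℤ
import Data.Integer.Properties as ℤ
open import Data.Product using (_×_; _,_; ∃-syntax)
open import Data.Rational as ℚ using (ℚ; mkℚ; 0ℚ; 1ℚ; ½; _+_; _*_; -_; _-_; ≢-nonZero)
import Data.Rational.Properties as ℚ
import Data.Rational.Unnormalised as ℚᵘ
import Data.Rational.Unnormalised.Properties as ℚᵘ
open import Data.Sum using (inj₁; inj₂)
open import Function using (_∘_; id)
open import Relation.Binary.PropositionalEquality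
  using (_≡_; refl; sym; trans; cong; cong₂; subst; module ≡-Reasoning)
import Relation.Binary.Reasoning.Setoid
import Algebra.Properties.CommutativeSemigroup ℕ.+-commutativeSemigroup as ℕ+
import Algebra.Properties.CommutativeSemigroup (CommutativeRing.+-commutativeSemigroup ℚ.+-*-commutativeRing) as ℚ+
open import Relation.Nullary using (yes; no; ¬_)
open import Tactic.RingSolver using (solve-∀)
import Tactic.RingSolver.Core.AlmostCommutativeRing as Reflective

-- Record the last step of a path.  The number N n j x of admissible paths of
-- length n that end at height j with last step x satisfies a linear recurrence
-- in n (remove the last step), so the generating functions gf j x solve the
-- system  gf j x = [j = 0, x = D] + z · Σ gf j′ x′  over the admissible
-- predecessors (j′, x′) of (j, x).  Let t = 1/(z r₁), the power series root of
-- 1 − (1 + z²) t + (2z² − z⁴) t² = 0, and w = z² t.  The system is solved by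
-- geometric sequences in v = z t = 1/r₁ with coefficients α = 1/(1 + w),
-- γ = w²/((1 + w)(1 − 2w)) and β = 1 + γ − α.  Summing over the last step gives
-- s_j = (1 + 2γ) v^j, and 1 + 2γ = t · (z⁴ + z⁴g₀ + z²g₀ − z² + 1) once g₀ is
-- eliminated; this is the first closed form, and the second one merely
-- rewrites 2 z r₁ = 1 + z² + √(1 − 6z² + 5z⁴).

-- Finite sums and formal power series over ℚ

ℚ-ring : Reflective.AlmostCommutativeRing _ _
ℚ-ring = Reflective.fromCommutativeRing ℚ.+-*-commutativeRing isZero
  where
  isZero : (x : ℚ) → Maybe (0ℚ ≡ x)
  isZero x with x ℚ.≟ 0ℚ
  ... | yes x≡0 = just (sym x≡0)
  ... | no  _   = nothing

∑ : ℕ → (ℕ → ℚ) → ℚ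
∑ zero    f = 0ℚ
∑ (suc n) f = f 0 + ∑ n (f ∘ suc)

sumℚ-map-applyUpTo : ∀ n (f : ℕ → ℚ) (g : ℕ → ℕ) → sumℚ (map f (applyUpTo g n)) ≡ ∑ n (f ∘ g)
sumℚ-map-applyUpTo zero    f g = refl
sumℚ-map-applyUpTo (suc n) f g = cong (f (g 0) +_) (sumℚ-map-applyUpTo n f (g ∘ suc))

sumℚ-map-upTo : ∀ n (f : ℕ → ℚ) → sumℚ (map f (upTo n)) ≡ ∑ n f
sumℚ-map-upTo n f = sumℚ-map-applyUpTo n f id

∑-cong : ∀ n {f g : ℕ → ℚ} → (∀ k → k < n → f k ≡ g k) → ∑ n f ≡ ∑ n g
∑-cong zero    f≡g = refl
∑-cong (suc n) f≡g = cong₂ _+_ (f≡g 0 (s≤s z≤n)) (∑-cong n (λ k k<n → f≡g (suc k) (s≤s k<n)))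

∑-distrib-+ : ∀ n (f g : ℕ → ℚ) → ∑ n (λ k → f k + g k) ≡ ∑ n f + ∑ n g
∑-distrib-+ zero    f g = refl
∑-distrib-+ (suc n) f g =
  trans (cong (f 0 + g 0 +_) (∑-distrib-+ n (f ∘ suc) (g ∘ suc)))
        (ℚ+.interchange (f 0) (g 0) (∑ n (f ∘ suc)) (∑ n (g ∘ suc)))

*-distribˡ-∑ : ∀ n c (f : ℕ → ℚ) → ∑ n (λ k → c * f k) ≡ c * ∑ n f
*-distribˡ-∑ zero    c f = sym (ℚ.*-zeroʳ c)
*-distribˡ-∑ (suc n) c f =
  trans (cong (c * f 0 +_) (*-distribˡ-∑ n c (f ∘ suc))) (sym (ℚ.*-distribˡ-+ c (f 0) (∑ n (f ∘ suc))))

∑-zero : ∀ n → ∑ n (λ _ → 0ℚ) ≡ 0ℚ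
∑-zero zero    = refl
∑-zero (suc n) = trans (ℚ.+-identityˡ _) (∑-zero n)

∑-last : ∀ n (f : ℕ → ℚ) → ∑ (suc n) f ≡ ∑ n f + f n
∑-last zero    f = ℚ.+-comm (f 0) 0ℚ
∑-last (suc n) f = trans (cong (f 0 +_) (∑-last n (f ∘ suc))) (sym (ℚ.+-assoc (f 0) _ _))

∑-reverse : ∀ n (f : ℕ → ℚ) → ∑ n f ≡ ∑ n (λ k → f (n ∸ suc k))
∑-reverse zero    f = refl
∑-reverse (suc n) f = begin
  f 0 + ∑ n (f ∘ suc)                        ≡⟨ cong (f 0 +_) (∑-reverse n (f ∘ suc)) ⟩
  f 0 + ∑ n (λ k → f (suc (n ∸ suc k)))      ≡⟨ ℚ.+-comm (f 0) _ ⟩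
  ∑ n (λ k → f (suc (n ∸ suc k))) + f 0      ≡⟨ cong₂ _+_ (∑-cong n (λ k k<n → cong f (sym (ℕ.+-∸-assoc 1 k<n))))
                                                          (cong f (sym (ℕ.n∸n≡0 n))) ⟩
  ∑ n (λ k → f (suc n ∸ suc k)) + f (n ∸ n)  ≡⟨ sym (∑-last n (λ k → f (suc n ∸ suc k))) ⟩
  ∑ (suc n) (λ k → f (suc n ∸ suc k))        ∎
  where open ≡-Reasoning

infix 4 _≈_
_≈_ : FPS → FPS → Set
f ≈ g = ∀ n → f n ≡ g n

neg : FPS → FPS
neg f n = - f n

0F 1F : FPS
0F = con 0ℚ
1F = con 1ℚ

tail : FPS → FPS
tail f = f ∘ suc

⊛-coeff : ∀ f g n → (f ⊛ g) n ≡ ∑ (suc n) (λ k → f k * g (n ∸ k))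
⊛-coeff f g n = sumℚ-map-upTo (suc n) (λ k → f k * g (n ∸ k))

⊛-head : ∀ f g → (f ⊛ g) 0 ≡ f 0 * g 0
⊛-head f g = trans (⊛-coeff f g 0) (ℚ.+-identityʳ _)

⊛-suc : ∀ f g n → (f ⊛ g) (suc n) ≡ f 0 * g (suc n) + (tail f ⊛ g) n
⊛-suc f g n = trans (⊛-coeff f g (suc n)) (cong (f 0 * g (suc n) +_) (sym (⊛-coeff (tail f) g n)))

⊛-cong : ∀ {f f′ g g′} → f ≈ f′ → g ≈ g′ → f ⊛ g ≈ f′ ⊛ g′
⊛-cong {f} {f′} {g} {g′} f≈f′ g≈g′ n = begin
  (f ⊛ g) n                                 ≡⟨ ⊛-coeff f g n ⟩
  ∑ (suc n) (λ k → f k * g (n ∸ k))         ≡⟨ ∑-cong (suc n) (λ k _ → cong₂ _*_ (f≈f′ k) (g≈g′ (n ∸ k))) ⟩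
  ∑ (suc n) (λ k → f′ k * g′ (n ∸ k))       ≡⟨ sym (⊛-coeff f′ g′ n) ⟩
  (f′ ⊛ g′) n                               ∎
  where open ≡-Reasoning

⊛-distribʳ-⊕ : ∀ f g h → (f ⊕ g) ⊛ h ≈ f ⊛ h ⊕ g ⊛ h
⊛-distribʳ-⊕ f g h n = begin
  ((f ⊕ g) ⊛ h) n                                             ≡⟨ ⊛-coeff (f ⊕ g) h n ⟩
  ∑ (suc n) (λ k → (f k + g k) * h (n ∸ k))                   ≡⟨ ∑-cong (suc n) (λ k _ → ℚ.*-distribʳ-+ (h (n ∸ k)) (f k) (g k)) ⟩
  ∑ (suc n) (λ k → f k * h (n ∸ k) + g k * h (n ∸ k))         ≡⟨ ∑-distrib-+ (suc n) (λ k → f k * h (n ∸ k)) (λ k → g k * h (n ∸ k)) ⟩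
  ∑ (suc n) (λ k → f k * h (n ∸ k)) + ∑ (suc n) (λ k → g k * h (n ∸ k))
                                                              ≡⟨ sym (cong₂ _+_ (⊛-coeff f h n) (⊛-coeff g h n)) ⟩
  (f ⊛ h) n + (g ⊛ h) n                                       ∎
  where open ≡-Reasoning

⊛-scaleˡ : ∀ c f h n → ((λ k → c * f k) ⊛ h) n ≡ c * (f ⊛ h) n
⊛-scaleˡ c f h n = begin
  ((λ k → c * f k) ⊛ h) n                     ≡⟨ ⊛-coeff (λ k → c * f k) h n ⟩
  ∑ (suc n) (λ k → c * f k * h (n ∸ k))       ≡⟨ ∑-cong (suc n) (λ k _ → ℚ.*-assoc c (f k) (h (n ∸ k))) ⟩
  ∑ (suc n) (λ k → c * (f k * h (n ∸ k)))     ≡⟨ *-distribˡ-∑ (suc n) c (λ k → f k * h (n ∸ k)) ⟩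
  c * ∑ (suc n) (λ k → f k * h (n ∸ k))       ≡⟨ cong (c *_) (sym (⊛-coeff f h n)) ⟩
  c * (f ⊛ h) n                               ∎
  where open ≡-Reasoning

⊛-comm : ∀ f g → f ⊛ g ≈ g ⊛ f
⊛-comm f g n = begin
  (f ⊛ g) n                                          ≡⟨ ⊛-coeff f g n ⟩
  ∑ (suc n) (λ k → f k * g (n ∸ k))                  ≡⟨ ∑-reverse (suc n) (λ k → f k * g (n ∸ k)) ⟩
  ∑ (suc n) (λ k → f (n ∸ k) * g (n ∸ (n ∸ k)))      ≡⟨ ∑-cong (suc n) swap ⟩
  ∑ (suc n) (λ k → g k * f (n ∸ k))                  ≡⟨ sym (⊛-coeff g f n) ⟩
  (g ⊛ f) n                                          ∎
  where
  open ≡-Reasoning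
  swap : ∀ k → k < suc n → f (n ∸ k) * g (n ∸ (n ∸ k)) ≡ g k * f (n ∸ k)
  swap k k<1+n = trans (cong (λ i → f (n ∸ k) * g i) (ℕ.m∸[m∸n]≡n (ℕ.≤-pred k<1+n)))
                       (ℚ.*-comm (f (n ∸ k)) (g k))

⊛-assoc : ∀ f g h → (f ⊛ g) ⊛ h ≈ f ⊛ (g ⊛ h)
⊛-assoc f g h zero = begin
  ((f ⊛ g) ⊛ h) 0        ≡⟨ trans (⊛-head (f ⊛ g) h) (cong (_* h 0) (⊛-head f g)) ⟩
  f 0 * g 0 * h 0        ≡⟨ ℚ.*-assoc (f 0) (g 0) (h 0) ⟩
  f 0 * (g 0 * h 0)      ≡⟨ sym (trans (⊛-head f (g ⊛ h)) (cong (f 0 *_) (⊛-head g h))) ⟩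
  (f ⊛ (g ⊛ h)) 0        ∎
  where open ≡-Reasoning
⊛-assoc f g h (suc n) = begin
  ((f ⊛ g) ⊛ h) (suc n)                                         ≡⟨ ⊛-suc (f ⊛ g) h n ⟩
  (f ⊛ g) 0 * h (suc n) + (tail (f ⊛ g) ⊛ h) n                  ≡⟨ cong₂ (λ a b → a * h (suc n) + b) (⊛-head f g)
                                                                         (⊛-cong {g = h} (⊛-suc f g) (λ _ → refl) n) ⟩
  f 0 * g 0 * h (suc n) + (((λ k → f 0 * g (suc k)) ⊕ tail f ⊛ g) ⊛ h) n
                                                                ≡⟨ cong (f 0 * g 0 * h (suc n) +_) (⊛-distribʳ-⊕ (λ k → f 0 * g (suc k)) (tail f ⊛ g) h n) ⟩
  f 0 * g 0 * h (suc n) + (((λ k → f 0 * g (suc k)) ⊛ h) n + ((tail f ⊛ g) ⊛ h) n)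
                                                                ≡⟨ cong₂ (λ a b → f 0 * g 0 * h (suc n) + (a + b))
                                                                         (⊛-scaleˡ (f 0) (tail g) h n) (⊛-assoc (tail f) g h n) ⟩
  f 0 * g 0 * h (suc n) + (f 0 * (tail g ⊛ h) n + (tail f ⊛ (g ⊛ h)) n)
                                                                ≡⟨ regroup (f 0) (g 0) (h (suc n)) _ _ ⟩
  f 0 * (g 0 * h (suc n) + (tail g ⊛ h) n) + (tail f ⊛ (g ⊛ h)) n
                                                                ≡⟨ cong (λ a → f 0 * a + (tail f ⊛ (g ⊛ h)) n) (sym (⊛-suc g h n)) ⟩
  f 0 * (g ⊛ h) (suc n) + (tail f ⊛ (g ⊛ h)) n                  ≡⟨ sym (⊛-suc f (g ⊛ h) n) ⟩
  (f ⊛ (g ⊛ h)) (suc n)                                         ∎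
  where
  open ≡-Reasoning
  regroup : ∀ a b c d e → a * b * c + (a * d + e) ≡ a * (b * c + d) + e
  regroup = solve-∀ ℚ-ring

⊛-identityˡ : ∀ f → 1F ⊛ f ≈ f
⊛-identityˡ f n = begin
  (1F ⊛ f) n                                      ≡⟨ ⊛-coeff 1F f n ⟩
  1ℚ * f n + ∑ n (λ k → 0ℚ * f (n ∸ suc k))       ≡⟨ cong₂ _+_ (ℚ.*-identityˡ (f n))
                                                            (trans (∑-cong n (λ k _ → ℚ.*-zeroˡ (f (n ∸ suc k)))) (∑-zero n)) ⟩
  f n + 0ℚ                                        ≡⟨ ℚ.+-identityʳ (f n) ⟩
  f n                                             ∎
  where open ≡-Reasoning

FPS-isCommutativeRing : IsCommutativeRing _≈_ _⊕_ _⊛_ neg 0F 1F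
FPS-isCommutativeRing = record
  { isRing = record
    { +-isAbelianGroup = record
      { isGroup = record
        { isMonoid = record
          { isSemigroup = record
            { isMagma = record
              { isEquivalence = record { refl = λ _ → refl ; sym = λ p n → sym (p n) ; trans = λ p q n → trans (p n) (q n) }
              ; ∙-cong = λ p q n → cong₂ _+_ (p n) (q n) }
            ; assoc = λ f g h n → ℚ.+-assoc (f n) (g n) (h n) }
          ; identity = ⊕-identityˡ , ⊕-identityʳ }
        ; inverse = ⊕-inverseˡ , ⊕-inverseʳ
        ; ⁻¹-cong = λ p n → cong -_ (p n) }
      ; comm = λ f g n → ℚ.+-comm (f n) (g n) }
    ; *-cong = ⊛-cong
    ; *-assoc = ⊛-assoc
    ; *-identity = ⊛-identityˡ , λ f n → trans (⊛-comm f 1F n) (⊛-identityˡ f n)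
    ; distrib = (λ f g h n → trans (⊛-comm f (g ⊕ h) n)
                               (trans (⊛-distribʳ-⊕ g h f n) (cong₂ _+_ (⊛-comm g f n) (⊛-comm h f n))))
              , (λ f g h → ⊛-distribʳ-⊕ g h f) }
  ; *-comm = ⊛-comm }
  where
  ⊕-identityˡ : ∀ f → 0F ⊕ f ≈ f
  ⊕-identityˡ f zero    = ℚ.+-identityˡ (f 0)
  ⊕-identityˡ f (suc n) = ℚ.+-identityˡ (f (suc n))
  ⊕-identityʳ : ∀ f → f ⊕ 0F ≈ f
  ⊕-identityʳ f zero    = ℚ.+-identityʳ (f 0)
  ⊕-identityʳ f (suc n) = ℚ.+-identityʳ (f (suc n))
  ⊕-inverseˡ : ∀ f → neg f ⊕ f ≈ 0F
  ⊕-inverseˡ f zero    = ℚ.+-inverseˡ (f 0)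
  ⊕-inverseˡ f (suc n) = ℚ.+-inverseˡ (f (suc n))
  ⊕-inverseʳ : ∀ f → f ⊕ neg f ≈ 0F
  ⊕-inverseʳ f zero    = ℚ.+-inverseʳ (f 0)
  ⊕-inverseʳ f (suc n) = ℚ.+-inverseʳ (f (suc n))

FPS-commutativeRing : CommutativeRing _ _
FPS-commutativeRing = record { isCommutativeRing = FPS-isCommutativeRing }

open CommutativeRing FPS-commutativeRing
  using (setoid; +-cong; -‿cong; *-cong; *-assoc; *-comm; *-identityˡ; *-identityʳ)
  renaming (refl to ≈-refl; sym to ≈-sym; trans to ≈-trans)

open import Algebra.Properties.CommutativeSemigroup
  (CommutativeRing.*-commutativeSemigroup FPS-commutativeRing) using () renaming (interchange to ⊛-interchange)

FPS-almostCommutativeRing : AlmostCommutativeRing _ _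
FPS-almostCommutativeRing = fromCommutativeRing FPS-commutativeRing

con-+ : ∀ a b → con (a + b) ≈ con a ⊕ con b
con-+ a b zero    = refl
con-+ a b (suc n) = sym (ℚ.+-identityʳ 0ℚ)

con-* : ∀ a b → con (a * b) ≈ con a ⊛ con b
con-* a b zero    = sym (⊛-head (con a) (con b))
con-* a b (suc n) = sym (begin
  (con a ⊛ con b) (suc n)           ≡⟨ ⊛-suc (con a) (con b) n ⟩
  a * 0ℚ + (tail (con a) ⊛ con b) n ≡⟨ cong₂ _+_ (ℚ.*-zeroʳ a) (⊛-coeff (tail (con a)) (con b) n) ⟩
  0ℚ + ∑ (suc n) (λ k → 0ℚ * con b (n ∸ k))
                                    ≡⟨ cong (0ℚ +_) (trans (∑-cong (suc n) (λ k _ → ℚ.*-zeroˡ (con b (n ∸ k)))) (∑-zero (suc n))) ⟩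
  0ℚ + 0ℚ                           ∎)
  where open ≡-Reasoning

con-neg : ∀ a → con (- a) ≈ neg (con a)
con-neg a zero    = refl
con-neg a (suc n) = refl

con-morphism : ℚ.+-*-rawRing -Raw-AlmostCommutative⟶ FPS-almostCommutativeRing
con-morphism = record
  { ⟦_⟧ = con ; +-homo = con-+ ; *-homo = con-* ; -‿homo = con-neg
  ; 0-homo = λ _ → refl ; 1-homo = λ _ → refl }

con-≟ : ∀ a b → Maybe (con a ≈ con b)
con-≟ a b with a ℚ.≟ b
... | yes refl = just (λ _ → refl)
... | no  _    = nothing

open import Algebra.Solver.Ring ℚ.+-*-rawRing FPS-almostCommutativeRing con-morphism con-≟
  using (solve; _:=_; _:+_; _:-_; _:*_; :-_) renaming (con to K)

z⊛-zero : ∀ f → (z ⊛ f) 0 ≡ 0ℚ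
z⊛-zero f = trans (⊛-head z f) (ℚ.*-zeroˡ (f 0))

z⊛-suc : ∀ f n → (z ⊛ f) (suc n) ≡ f n
z⊛-suc f n = begin
  (z ⊛ f) (suc n)                 ≡⟨ ⊛-suc z f n ⟩
  0ℚ * f (suc n) + (tail z ⊛ f) n ≡⟨ cong₂ _+_ (ℚ.*-zeroˡ (f (suc n))) (⊛-cong {g = f} tail-z (λ _ → refl) n) ⟩
  0ℚ + (1F ⊛ f) n                 ≡⟨ trans (ℚ.+-identityˡ _) (⊛-identityˡ f n) ⟩
  f n                             ∎
  where
  open ≡-Reasoning
  tail-z : tail z ≈ 1F
  tail-z zero    = refl
  tail-z (suc _) = refl

module ≈-Reasoning = Relation.Binary.Reasoning.Setoid setoid

-- Reciprocals, square roots and powers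

at-∷ʳ-< : ∀ (xs : List ℚ) y {i} → i < length xs → at (xs ∷ʳ y) i ≡ at xs i
at-∷ʳ-< (x ∷ xs) y {zero}  _         = refl
at-∷ʳ-< (x ∷ xs) y {suc i} (s≤s i<n) = at-∷ʳ-< xs y i<n

at-∷ʳ-length : ∀ (xs : List ℚ) y → at (xs ∷ʳ y) (length xs) ≡ y
at-∷ʳ-length []       y = refl
at-∷ʳ-length (x ∷ xs) y = at-∷ʳ-length xs y

length-∷ʳ : ∀ (xs : List ℚ) y → length (xs ∷ʳ y) ≡ suc (length xs)
length-∷ʳ []       y = refl
length-∷ʳ (x ∷ xs) y = cong suc (length-∷ʳ xs y)

module AppendOnly (L : ℕ → List ℚ) (initial : length (L 0) ≡ 1)
                  (appends : ∀ n → ∃[ x ] L (suc n) ≡ L n ∷ʳ x) where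

  length-L : ∀ n → length (L n) ≡ suc n
  length-L zero    = initial
  length-L (suc n) with appends n
  ... | x , eq = trans (cong length eq) (trans (length-∷ʳ (L n) x) (cong suc (length-L n)))

  at-L-new : ∀ n x → at (L n ∷ʳ x) (suc n) ≡ x
  at-L-new n x = trans (cong (at (L n ∷ʳ x)) (sym (length-L n))) (at-∷ʳ-length (L n) x)

  at-L-stable : ∀ {i n} → i ≤ n → at (L n) i ≡ at (L i) i
  at-L-stable {n = zero}  z≤n = refl
  at-L-stable {i} {suc n} i≤1+n with ℕ.m≤n⇒m<n∨m≡n i≤1+n | appends n
  ... | inj₂ refl      | _      = refl
  ... | inj₁ (s≤s i≤n) | x , eq = begin
    at (L (suc n)) i     ≡⟨ cong (λ xs → at xs i) eq ⟩
    at (L n ∷ʳ x) i      ≡⟨ at-∷ʳ-< (L n) x (subst (i <_) (sym (length-L n)) (s≤s i≤n)) ⟩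
    at (L n) i           ≡⟨ at-L-stable i≤n ⟩
    at (L i) i           ∎
    where open ≡-Reasoning

inv0-inverse : ∀ c → ¬ c ≡ 0ℚ → c * inv0 c ≡ 1ℚ
inv0-inverse c c≢0 with c ℚ.≟ 0ℚ
... | yes c≡0 = ⊥-elim (c≢0 c≡0)
... | no  c≢0 = ℚ.*-inverseʳ c {{≢-nonZero c≢0}}

⊛-inverseʳ : ∀ f → ¬ f 0 ≡ 0ℚ → f ⊛ inv f ≈ 1F
⊛-inverseʳ f f₀≢0 zero    = trans (⊛-head f (inv f)) (inv0-inverse (f 0) f₀≢0)
⊛-inverseʳ f f₀≢0 (suc n) = begin
  (f ⊛ inv f) (suc n)                       ≡⟨ ⊛-suc f (inv f) n ⟩
  f 0 * inv f (suc n) + (tail f ⊛ inv f) n  ≡⟨ cong₂ (λ a b → f 0 * a + b) (at-L-new n _) (sym convolution) ⟩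
  f 0 * - (inv0 (f 0) * S) + S              ≡⟨ cancel (f 0) (inv0 (f 0)) S ⟩
  - (f 0 * inv0 (f 0) * S) + S              ≡⟨ cong (λ c → - (c * S) + S) (inv0-inverse (f 0) f₀≢0) ⟩
  - (1ℚ * S) + S                            ≡⟨ trans (cong (λ x → - x + S) (ℚ.*-identityˡ S)) (ℚ.+-inverseˡ S) ⟩
  0ℚ                                        ∎
  where
  open ≡-Reasoning
  open AppendOnly (invList f) refl (λ _ → _ , refl)
  S = sumℚ (map (λ k → f (suc k) * at (invList f n) (n ∸ k)) (upTo (suc n)))
  convolution : S ≡ (tail f ⊛ inv f) n
  convolution = begin
    S                                                   ≡⟨ sumℚ-map-upTo (suc n) (λ k → f (suc k) * at (invList f n) (n ∸ k)) ⟩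
    ∑ (suc n) (λ k → f (suc k) * at (invList f n) (n ∸ k)) ≡⟨ ∑-cong (suc n) (λ k _ → cong (f (suc k) *_) (at-L-stable (ℕ.m∸n≤m n k))) ⟩
    ∑ (suc n) (λ k → f (suc k) * inv f (n ∸ k))         ≡⟨ sym (⊛-coeff (tail f) (inv f) n) ⟩
    (tail f ⊛ inv f) n                                  ∎
  cancel : ∀ a b c → a * - (b * c) + c ≡ - (a * b * c) + c
  cancel = solve-∀ ℚ-ring

sqrt1-squared : ∀ f → f 0 ≡ 1ℚ → sqrt1 f ⊛ sqrt1 f ≈ f
sqrt1-squared f f₀≡1 zero    = trans (⊛-head (sqrt1 f) (sqrt1 f)) (trans (ℚ.*-identityˡ 1ℚ) (sym f₀≡1))
sqrt1-squared f f₀≡1 (suc n) = begin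
  (r ⊛ r) (suc n)                                             ≡⟨ ⊛-coeff r r (suc n) ⟩
  1ℚ * r (suc n) + ∑ (suc n) (λ k → r (suc k) * r (n ∸ k))   ≡⟨ cong (1ℚ * r (suc n) +_) (∑-last n (λ k → r (suc k) * r (n ∸ k))) ⟩
  1ℚ * r (suc n) + (∑ n (λ k → r (suc k) * r (n ∸ k)) + r (suc n) * r (n ∸ n))
                                                              ≡⟨ cong₂ (λ a b → 1ℚ * r (suc n) + (a + r (suc n) * r b)) (sym cross-terms) (ℕ.n∸n≡0 n) ⟩
  1ℚ * r (suc n) + (S + r (suc n) * 1ℚ)                       ≡⟨ double (r (suc n)) S ⟩
  r (suc n) + r (suc n) + S                                   ≡⟨ cong (λ x → x + x + S) (at-L-new n _) ⟩
  ½ * (f (suc n) - S) + ½ * (f (suc n) - S) + S               ≡⟨ halves (f (suc n)) S ⟩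
  f (suc n)                                                   ∎
  where
  open ≡-Reasoning
  open AppendOnly (sqrtList f) refl (λ _ → _ , refl)
  r = sqrt1 f
  S = sumℚ (map (λ k → at (sqrtList f n) (suc k) * at (sqrtList f n) (n ∸ k)) (upTo n))
  cross-terms : S ≡ ∑ n (λ k → r (suc k) * r (n ∸ k))
  cross-terms = trans (sumℚ-map-upTo n (λ k → at (sqrtList f n) (suc k) * at (sqrtList f n) (n ∸ k)))
    (∑-cong n (λ k k<n → cong₂ _*_ (at-L-stable k<n) (at-L-stable (ℕ.m∸n≤m n k))))
  double : ∀ x S → 1ℚ * x + (S + x * 1ℚ) ≡ x + x + S
  double = solve-∀ ℚ-ring
  halves : ∀ a S → ½ * (a - S) + ½ * (a - S) + S ≡ a
  halves = solve-∀ ℚ-ring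

⊛-cancelʳ : ∀ {f g u u′} → u ⊛ u′ ≈ 1F → f ⊛ u ≈ g ⊛ u → f ≈ g
⊛-cancelʳ {f} {g} {u} {u′} uu′≈1 fu≈gu = begin
  f               ≈⟨ ≈-sym (*-identityʳ f) ⟩
  f ⊛ 1F          ≈⟨ *-cong (≈-refl {f}) (≈-sym uu′≈1) ⟩
  f ⊛ (u ⊛ u′)    ≈⟨ ≈-sym (*-assoc f u u′) ⟩
  (f ⊛ u) ⊛ u′    ≈⟨ *-cong fu≈gu (≈-refl {u′}) ⟩
  (g ⊛ u) ⊛ u′    ≈⟨ *-assoc g u u′ ⟩
  g ⊛ (u ⊛ u′)    ≈⟨ *-cong (≈-refl {g}) uu′≈1 ⟩
  g ⊛ 1F          ≈⟨ *-identityʳ g ⟩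
  g               ∎
  where open ≈-Reasoning

unit-head≢0 : ∀ f g → f ⊛ g ≈ 1F → ¬ f 0 ≡ 0ℚ
unit-head≢0 f g fg≈1 f₀≡0 = ℚ.1≢0 (begin
  1ℚ           ≡⟨ sym (fg≈1 0) ⟩
  (f ⊛ g) 0    ≡⟨ ⊛-head f g ⟩
  f 0 * g 0    ≡⟨ cong (_* g 0) f₀≡0 ⟩
  0ℚ * g 0     ≡⟨ ℚ.*-zeroˡ (g 0) ⟩
  0ℚ           ∎)
  where open ≡-Reasoning

inv-unique : ∀ f g → f ⊛ g ≈ 1F → inv f ≈ g
inv-unique f g fg≈1 = ⊛-cancelʳ fg≈1 (begin
  inv f ⊛ f  ≈⟨ *-comm (inv f) f ⟩
  f ⊛ inv f  ≈⟨ ⊛-inverseʳ f (unit-head≢0 f g fg≈1) ⟩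
  1F         ≈⟨ ≈-sym fg≈1 ⟩
  f ⊛ g      ≈⟨ *-comm f g ⟩
  g ⊛ f      ∎)
  where open ≈-Reasoning

z²⊛divZ2 : ∀ f → f 0 ≡ 0ℚ → f 1 ≡ 0ℚ → z² ⊛ divZ2 f ≈ f
z²⊛divZ2 f f₀≡0 f₁≡0 = ≈-trans (solve 2 (λ x g → (x :* (x :* K 1ℚ)) :* g := x :* (x :* g)) (λ _ → refl) z (divZ2 f)) shifted
  where
  shifted : z ⊛ (z ⊛ divZ2 f) ≈ f
  shifted zero          = trans (z⊛-zero (z ⊛ divZ2 f)) (sym f₀≡0)
  shifted (suc zero)    = trans (z⊛-suc (z ⊛ divZ2 f) 0) (trans (z⊛-zero (divZ2 f)) (sym f₁≡0))
  shifted (suc (suc n)) = trans (z⊛-suc (z ⊛ divZ2 f) (suc n)) (z⊛-suc (divZ2 f) n)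

pow-cong : ∀ {f g} k → f ≈ g → pow f k ≈ pow g k
pow-cong zero    f≈g = ≈-refl
pow-cong (suc k) f≈g = *-cong f≈g (pow-cong k f≈g)

pow-distrib-⊛ : ∀ f g k → pow (f ⊛ g) k ≈ pow f k ⊛ pow g k
pow-distrib-⊛ f g zero    = ≈-sym (⊛-identityˡ 1F)
pow-distrib-⊛ f g (suc k) = ≈-trans (*-cong (≈-refl {f ⊛ g}) (pow-distrib-⊛ f g k)) (⊛-interchange f g (pow f k) (pow g k))

pow-1F : ∀ k → pow 1F k ≈ 1F
pow-1F zero    = ≈-refl
pow-1F (suc k) = ≈-trans (*-cong (≈-refl {1F}) (pow-1F k)) (*-identityʳ 1F)

pow-inverse : ∀ f g k → f ⊛ g ≈ 1F → pow f k ⊛ pow g k ≈ 1F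
pow-inverse f g k fg≈1 = ≈-trans (≈-sym (pow-distrib-⊛ f g k)) (≈-trans (pow-cong k fg≈1) (pow-1F k))

≈-modulo : ∀ {f g a b} m → f ≈ g ⊕ m ⊛ (a ⊖ b) → a ≈ b → f ≈ g
≈-modulo {f} {g} {a} {b} m f≈ a≈b = begin
  f                ≈⟨ f≈ ⟩
  g ⊕ m ⊛ (a ⊖ b)  ≈⟨ +-cong (≈-refl {g}) (*-cong (≈-refl {m}) (+-cong a≈b (≈-refl {neg b}))) ⟩
  g ⊕ m ⊛ (b ⊖ b)  ≈⟨ solve 3 (λ g m b → g :+ m :* (b :- b) := g) (λ _ → refl) g m b ⟩
  g                ∎
  where open ≈-Reasoning

-- Counting paths by their last step

-- The empty path is treated as ending with a black down-step: at height 0 that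
-- allows exactly the steps allowed at the start (see checkNP-start).
data State : Set where
  stuck : State
  live  : ℕ → Step → State

move : Step → Step → ℕ → Maybe ℕ
move U R _             = nothing
move U _ h             = just (suc h)
move D _ zero          = nothing
move D U (suc zero)    = nothing   -- a peak at level 1
move D _ (suc h)       = just h
move R _ zero          = nothing
move R U _             = nothing
move R _ (suc h)       = just h

step : State → Step → State
step stuck      x = stuck
step (live h y) x = maybe′ (λ h′ → live h′ x) stuck (move x y h)

run : List Step → State
run = foldl step (live 0 D)

accepts : ℕ → State → Bool
accepts j stuck      = false
accepts j (live h _) = h ≡ᵇ j

prev : Step → Prev
prev U = pU
prev D = pD
prev R = pR

stuck-absorbs : ∀ w → foldl step stuck w ≡ stuck
stuck-absorbs []      = refl
stuck-absorbs (_ ∷ w) = stuck-absorbs w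

rejects : ∀ w j → false ≡ accepts j (foldl step stuck w)
rejects w j = cong (accepts j) (sym (stuck-absorbs w))

checkNP-run : ∀ h y w j → checkNP h (prev y) w j ≡ accepts j (foldl step (live h y) w)
checkNP-run h             y []      j = refl
checkNP-run h             R (U ∷ w) j = rejects w j
checkNP-run h             U (U ∷ w) j = checkNP-run (suc h) U w j
checkNP-run h             D (U ∷ w) j = checkNP-run (suc h) U w j
checkNP-run zero          U (D ∷ w) j = rejects w j
checkNP-run zero          D (D ∷ w) j = rejects w j
checkNP-run zero          R (D ∷ w) j = rejects w j
checkNP-run (suc zero)    U (D ∷ w) j = rejects w j
checkNP-run (suc (suc h)) U (D ∷ w) j = checkNP-run (suc h) D w j
checkNP-run (suc h)       D (D ∷ w) j = checkNP-run h D w j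
checkNP-run (suc h)       R (D ∷ w) j = checkNP-run h D w j
checkNP-run zero          U (R ∷ w) j = rejects w j
checkNP-run zero          D (R ∷ w) j = rejects w j
checkNP-run zero          R (R ∷ w) j = rejects w j
checkNP-run (suc h)       U (R ∷ w) j = rejects w j
checkNP-run (suc h)       D (R ∷ w) j = checkNP-run h R w j
checkNP-run (suc h)       R (R ∷ w) j = checkNP-run h R w j

checkNP-start : ∀ w j → checkNP 0 start w j ≡ checkNP 0 pD w j
checkNP-start []      j = refl
checkNP-start (U ∷ w) j = refl
checkNP-start (D ∷ w) j = refl
checkNP-start (R ∷ w) j = refl

letters : List Step
letters = U ∷ D ∷ R ∷ []

indicator : Bool → ℕ
indicator b = if b then 1 else 0

sameStep : Step → Step → Bool
sameStep U U = true
sameStep D D = true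
sameStep R R = true
sameStep _ _ = false

hits : ℕ → Step → State → ℕ
hits j x stuck      = 0
hits j x (live h y) = indicator (sameStep y x ∧ (h ≡ᵇ j))

-- The state (j, x) is entered only by the step x; sources j x lists the
-- states from which that step is allowed.
sources : ℕ → Step → List (ℕ × Step)
sources j       R = (suc j , D) ∷ (suc j , R) ∷ []
sources zero    U = []
sources (suc j) U = (j , U) ∷ (j , D) ∷ []
sources zero    D = (1 , D) ∷ (1 , R) ∷ []
sources (suc j) D = (2 ℕ.+ j , U) ∷ (2 ℕ.+ j , D) ∷ (2 ℕ.+ j , R) ∷ []

accepts-hits : ∀ j σ → indicator (accepts j σ) ≡ sum (map (λ x → hits j x σ) letters)
accepts-hits j stuck      = refl
accepts-hits j (live h U) = sym (ℕ.+-identityʳ _)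
accepts-hits j (live h D) = sym (ℕ.+-identityʳ _)
accepts-hits j (live h R) = sym (ℕ.+-identityʳ _)

hits-step-other : ∀ j x y σ → sameStep y x ≡ false → hits j x (step σ y) ≡ 0
hits-step-other j x y stuck      _  = refl
hits-step-other j x y (live h y′) y≠x with move y y′ h
... | nothing = refl
... | just h′ = cong (λ b → indicator (b ∧ (h′ ≡ᵇ j))) y≠x

hits-step-letters : ∀ j x σ → sum (map (hits j x ∘ step σ) letters) ≡ hits j x (step σ x)
hits-step-letters j U σ
  rewrite hits-step-other j U D σ refl | hits-step-other j U R σ refl = ℕ.+-identityʳ _
hits-step-letters j D σ
  rewrite hits-step-other j D U σ refl | hits-step-other j D R σ refl = ℕ.+-identityʳ _
hits-step-letters j R σ
  rewrite hits-step-other j R U σ refl | hits-step-other j R D σ refl = ℕ.+-identityʳ _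

hits-step : ∀ j x σ → hits j x (step σ x) ≡ sum (map (λ (j′ , x′) → hits j′ x′ σ) (sources j x))
hits-step zero          U stuck                   = refl
hits-step zero          U (live h U)              = refl
hits-step zero          U (live h D)              = refl
hits-step zero          U (live h R)              = refl
hits-step (suc j)       U stuck                   = refl
hits-step (suc j)       U (live h U)              = sym (ℕ.+-identityʳ _)
hits-step (suc j)       U (live h D)              = sym (ℕ.+-identityʳ _)
hits-step (suc j)       U (live h R)              = refl
hits-step zero          D stuck                   = refl
hits-step zero          D (live zero U)           = refl
hits-step zero          D (live zero D)           = refl
hits-step zero          D (live zero R)           = refl
hits-step zero          D (live (suc zero) U)     = refl
hits-step zero          D (live (suc (suc h)) U)  = refl
hits-step zero          D (live (suc h) D)        = sym (ℕ.+-identityʳ _)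
hits-step zero          D (live (suc h) R)        = sym (ℕ.+-identityʳ _)
hits-step (suc j)       D stuck                   = refl
hits-step (suc j)       D (live zero U)           = refl
hits-step (suc j)       D (live zero D)           = refl
hits-step (suc j)       D (live zero R)           = refl
hits-step (suc j)       D (live (suc zero) U)     = refl
hits-step (suc j)       D (live (suc (suc h)) U)  = sym (ℕ.+-identityʳ _)
hits-step (suc j)       D (live (suc h) D)        = sym (ℕ.+-identityʳ _)
hits-step (suc j)       D (live (suc h) R)        = sym (ℕ.+-identityʳ _)
hits-step j             R stuck                   = refl
hits-step j             R (live zero U)           = refl
hits-step j             R (live zero D)           = refl
hits-step j             R (live zero R)           = refl
hits-step j             R (live (suc h) U)        = refl
hits-step j             R (live (suc h) D)        = sym (ℕ.+-identityʳ _)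
hits-step j             R (live (suc h) R)        = sym (ℕ.+-identityʳ _)

module _ {A : Set} where

  sum-map-cong : ∀ {f g : A → ℕ} → (∀ x → f x ≡ g x) → ∀ xs → sum (map f xs) ≡ sum (map g xs)
  sum-map-cong f≡g xs = cong sum (List.map-cong f≡g xs)

  sum-map-+ : ∀ (f g : A → ℕ) xs → sum (map (λ x → f x ℕ.+ g x) xs) ≡ sum (map f xs) ℕ.+ sum (map g xs)
  sum-map-+ f g []       = refl
  sum-map-+ f g (x ∷ xs) = trans (cong (f x ℕ.+ g x ℕ.+_) (sum-map-+ f g xs))
                                 (ℕ+.interchange (f x) (g x) (sum (map f xs)) (sum (map g xs)))

  sum-map-zero : ∀ xs → sum (map (λ (_ : A) → 0) xs) ≡ 0
  sum-map-zero []       = refl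
  sum-map-zero (_ ∷ xs) = sum-map-zero xs

  sum-map-concatMap : ∀ {B : Set} (g : A → ℕ) (f : B → List A) xs →
                      sum (map g (concatMap f xs)) ≡ sum (map (λ x → sum (map g (f x))) xs)
  sum-map-concatMap g f []       = refl
  sum-map-concatMap g f (x ∷ xs) = begin
    sum (map g (f x ++ concatMap f xs))               ≡⟨ cong sum (List.map-++ g (f x) _) ⟩
    sum (map g (f x) ++ map g (concatMap f xs))       ≡⟨ sum-++ (map g (f x)) _ ⟩
    sum (map g (f x)) ℕ.+ sum (map g (concatMap f xs))            ≡⟨ cong (sum (map g (f x)) ℕ.+_) (sum-map-concatMap g f xs) ⟩
    sum (map g (f x)) ℕ.+ sum (map (λ x → sum (map g (f x))) xs)  ∎
    where open ≡-Reasoning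

sum-map-comm : ∀ {A B : Set} (f : A → B → ℕ) xs ys →
               sum (map (λ x → sum (map (f x) ys)) xs) ≡ sum (map (λ y → sum (map (λ x → f x y) xs)) ys)
sum-map-comm f []       ys = sym (sum-map-zero ys)
sum-map-comm f (x ∷ xs) ys =
  trans (cong (sum (map (f x) ys) ℕ.+_) (sum-map-comm f xs ys))
        (sym (sum-map-+ (f x) (λ y → sum (map (λ x → f x y) xs)) ys))

sum-words-suc : ∀ n (g : List Step → ℕ) →
                sum (map g (words (suc n))) ≡ sum (map (λ w → sum (map (λ x → g (x ∷ w)) letters)) (words n))
sum-words-suc n g = sum-map-concatMap g (λ w → (U ∷ w) ∷ (D ∷ w) ∷ (R ∷ w) ∷ []) (words n)

sum-words-snoc : ∀ n (g : List Step → ℕ) →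
                 sum (map g (words (suc n))) ≡ sum (map (λ w → sum (map (λ x → g (w ∷ʳ x)) letters)) (words n))
sum-words-snoc zero    g = sym (ℕ.+-identityʳ _)
sum-words-snoc (suc n) g = begin
  sum (map g (words (2 ℕ.+ n)))
    ≡⟨ sum-words-suc (suc n) g ⟩
  sum (map (λ w → sum (map (λ x → g (x ∷ w)) letters)) (words (suc n)))
    ≡⟨ sum-words-snoc n (λ w → sum (map (λ x → g (x ∷ w)) letters)) ⟩
  sum (map (λ w → sum (map (λ y → sum (map (λ x → g (x ∷ w ∷ʳ y)) letters)) letters)) (words n))
    ≡⟨ sum-map-cong (λ w → sum-map-comm (λ y x → g (x ∷ w ∷ʳ y)) letters letters) (words n) ⟩
  sum (map (λ w → sum (map (λ x → sum (map (λ y → g (x ∷ w ∷ʳ y)) letters)) letters)) (words n))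
    ≡⟨ sum-words-suc n (λ w → sum (map (λ y → g (w ∷ʳ y)) letters)) ⟨
  sum (map (λ w → sum (map (λ y → g (w ∷ʳ y)) letters)) (words (suc n)))
    ∎
  where open ≡-Reasoning

paths : ℕ → (State → ℕ) → ℕ
paths n f = sum (map (f ∘ run) (words n))

paths-suc : ∀ n f → paths (suc n) f ≡ paths n (λ σ → sum (map (f ∘ step σ) letters))
paths-suc n f = trans (sum-words-snoc n (f ∘ run))
  (sum-map-cong (λ w → sum-map-cong (λ x → cong f (List.foldl-∷ʳ step (live 0 D) x w)) letters) (words n))

N : ℕ → ℕ → Step → ℕ
N n j x = paths n (hits j x)

N-suc : ∀ n j x → N (suc n) j x ≡ sum (map (λ (j′ , x′) → N n j′ x′) (sources j x))
N-suc n j x = begin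
  N (suc n) j x
    ≡⟨ paths-suc n (hits j x) ⟩
  paths n (λ σ → sum (map (hits j x ∘ step σ) letters))
    ≡⟨ sum-map-cong (λ w → trans (hits-step-letters j x (run w)) (hits-step j x (run w))) (words n) ⟩
  sum (map (λ w → sum (map (λ (j′ , x′) → hits j′ x′ (run w)) (sources j x))) (words n))
    ≡⟨ sum-map-comm (λ w (j′ , x′) → hits j′ x′ (run w)) (words n) (sources j x) ⟩
  sum (map (λ (j′ , x′) → N n j′ x′) (sources j x))
    ∎
  where open ≡-Reasoning

length-filter-≟true : ∀ {A : Set} (P : A → Bool) xs →
                      length (filter (λ x → P x Bool.≟ true) xs) ≡ sum (map (indicator ∘ P) xs)
length-filter-≟true P []       = refl
length-filter-≟true P (x ∷ xs) with P x
... | true  = cong suc (length-filter-≟true P xs)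
... | false = length-filter-≟true P xs

a≡∑N : ∀ n j → a n j ≡ sum (map (N n j) letters)
a≡∑N n j = begin
  a n j
    ≡⟨ length-filter-≟true (λ w → checkNP 0 start w j) (words n) ⟩
  sum (map (λ w → indicator (checkNP 0 start w j)) (words n))
    ≡⟨ sum-map-cong (λ w → cong indicator (trans (checkNP-start w j) (checkNP-run 0 D w j))) (words n) ⟩
  sum (map (λ w → indicator (accepts j (run w))) (words n))
    ≡⟨ sum-map-cong (λ w → accepts-hits j (run w)) (words n) ⟩
  sum (map (λ w → sum (map (λ x → hits j x (run w)) letters)) (words n))
    ≡⟨ sum-map-comm (λ w x → hits j x (run w)) (words n) letters ⟩
  sum (map (N n j) letters)
    ∎
  where open ≡-Reasoning

-- The series that solve the counting system

-- T = z r₁ and v = 1/r₁ in the notation of the theorem.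
T t w v α δ γ β c₀ : FPS
T = con ½ ⊛ (con 1ℚ ⊕ z² ⊕ Δ)
t = inv T
w = z² ⊛ t
v = z ⊛ t
α = inv (1F ⊕ w)
δ = inv (1F ⊖ (w ⊕ w))
γ = w ⊛ w ⊛ α ⊛ δ
β = 1F ⊕ γ ⊖ α
c₀ = 1F ⊕ γ ⊕ γ

T-inverse : T ⊛ t ≈ 1F
T-inverse = ⊛-inverseʳ T (λ ())

α-inverse : (1F ⊕ w) ⊛ α ≈ 1F
α-inverse = ⊛-inverseʳ (1F ⊕ w) (λ ())

δ-inverse : (1F ⊖ (w ⊕ w)) ⊛ δ ≈ 1F
δ-inverse = ⊛-inverseʳ (1F ⊖ (w ⊕ w)) (λ ())

Δ-squared : Δ ⊛ Δ ≈ con 1ℚ ⊖ con (qn 6) ⊛ z² ⊕ con (qn 5) ⊛ z⁴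
Δ-squared = sqrt1-squared _ refl

-- T is a root of X² − (1 + z²) X + 2z² − z⁴, whose discriminant is Δ².
t-quadratic : t ⊛ (1F ⊖ (w ⊕ w)) ≈ 1F ⊖ w ⊖ w ⊛ w
t-quadratic = ≈-modulo (con ½ ⊛ con ½ ⊛ (t ⊛ t)) (≈-modulo (1F ⊕ T ⊛ t ⊖ (1F ⊕ z²) ⊛ t) identity T-inverse) (≈-sym Δ-squared)
  where
  identity : t ⊛ (1F ⊖ (w ⊕ w)) ≈ 1F ⊖ w ⊖ w ⊛ w
                                   ⊕ con ½ ⊛ con ½ ⊛ (t ⊛ t) ⊛ (con 1ℚ ⊖ con (qn 6) ⊛ z² ⊕ con (qn 5) ⊛ z⁴ ⊖ Δ ⊛ Δ)
                                   ⊕ (1F ⊕ T ⊛ t ⊖ (1F ⊕ z²) ⊛ t) ⊛ (T ⊛ t ⊖ 1F)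
  identity = solve 3 (λ x y d →
      let x² = x :* (x :* K 1ℚ) ; x⁴ = x :* (x :* (x :* (x :* K 1ℚ))) ; u = x² :* y
          τ = K ½ :* (K 1ℚ :+ x² :+ d) in
      y :* (K 1ℚ :- (u :+ u))
        := K 1ℚ :- u :- u :* u
           :+ K ½ :* K ½ :* (y :* y) :* (K 1ℚ :- K (qn 6) :* x² :+ K (qn 5) :* x⁴ :- d :* d)
           :+ (K 1ℚ :+ τ :* y :- (K 1ℚ :+ x²) :* y) :* (τ :* y :- K 1ℚ))
    (λ _ → refl) z t Δ

w⊛α : w ⊛ α ≈ 1F ⊖ α
w⊛α = begin
  w ⊛ α                 ≈⟨ solve 2 (λ w a → w :* a := (K 1ℚ :+ w) :* a :- a) (λ _ → refl) w α ⟩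
  (1F ⊕ w) ⊛ α ⊖ α      ≈⟨ +-cong α-inverse (≈-refl {neg α}) ⟩
  1F ⊖ α                ∎
  where open ≈-Reasoning

[1-2w]⊛γ : (1F ⊖ (w ⊕ w)) ⊛ γ ≈ w ⊛ (w ⊛ α)
[1-2w]⊛γ = begin
  (1F ⊖ (w ⊕ w)) ⊛ γ                    ≈⟨ solve 3 (λ w a d → (K 1ℚ :- (w :+ w)) :* (w :* w :* a :* d)
                                                         := w :* (w :* a) :* ((K 1ℚ :- (w :+ w)) :* d)) (λ _ → refl) w α δ ⟩
  w ⊛ (w ⊛ α) ⊛ ((1F ⊖ (w ⊕ w)) ⊛ δ)    ≈⟨ *-cong (≈-refl {w ⊛ (w ⊛ α)}) δ-inverse ⟩
  w ⊛ (w ⊛ α) ⊛ 1F                      ≈⟨ *-identityʳ (w ⊛ (w ⊛ α)) ⟩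
  w ⊛ (w ⊛ α)                           ∎
  where open ≈-Reasoning

γ-rec : γ ≈ w ⊛ (β ⊕ γ)
γ-rec = begin
  γ                                          ≈⟨ solve 2 (λ w g → g := (K 1ℚ :- (w :+ w)) :* g :+ (w :+ w) :* g) (λ _ → refl) w γ ⟩
  (1F ⊖ (w ⊕ w)) ⊛ γ ⊕ (w ⊕ w) ⊛ γ           ≈⟨ +-cong [1-2w]⊛γ (≈-refl {(w ⊕ w) ⊛ γ}) ⟩
  w ⊛ (w ⊛ α) ⊕ (w ⊕ w) ⊛ γ                  ≈⟨ +-cong (*-cong (≈-refl {w}) w⊛α) (≈-refl {(w ⊕ w) ⊛ γ}) ⟩
  w ⊛ (1F ⊖ α) ⊕ (w ⊕ w) ⊛ γ                 ≈⟨ solve 3 (λ w a g → w :* (K 1ℚ :- a) :+ (w :+ w) :* g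
                                                              := w :* ((K 1ℚ :+ g :- a) :+ g)) (λ _ → refl) w α γ ⟩
  w ⊛ (β ⊕ γ)                                ∎
  where open ≈-Reasoning

β-rec : β ≈ w ⊛ (α ⊕ β ⊕ γ)
β-rec = ≈-sym (begin
  w ⊛ (α ⊕ β ⊕ γ)            ≈⟨ solve 4 (λ w a b g → w :* (a :+ b :+ g) := w :* a :+ w :* (b :+ g)) (λ _ → refl) w α β γ ⟩
  w ⊛ α ⊕ w ⊛ (β ⊕ γ)        ≈⟨ +-cong w⊛α (≈-sym γ-rec) ⟩
  1F ⊖ α ⊕ γ                 ≈⟨ solve 2 (λ a g → K 1ℚ :- a :+ g := K 1ℚ :+ g :- a) (λ _ → refl) α γ ⟩
  β                          ∎)
  where open ≈-Reasoning

α⊛t : α ⊛ t ≈ 1F ⊕ γ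
α⊛t = begin
  α ⊛ t                                         ≈⟨ *-identityʳ (α ⊛ t) ⟨
  α ⊛ t ⊛ 1F                                    ≈⟨ *-cong (≈-refl {α ⊛ t}) δ-inverse ⟨
  α ⊛ t ⊛ ((1F ⊖ (w ⊕ w)) ⊛ δ)                  ≈⟨ solve 4 (λ a y w d → a :* y :* ((K 1ℚ :- (w :+ w)) :* d)
                                                                  := a :* d :* (y :* (K 1ℚ :- (w :+ w)))) (λ _ → refl) α t w δ ⟩
  α ⊛ δ ⊛ (t ⊛ (1F ⊖ (w ⊕ w)))                  ≈⟨ *-cong (≈-refl {α ⊛ δ}) t-quadratic ⟩
  α ⊛ δ ⊛ (1F ⊖ w ⊖ w ⊛ w)                      ≈⟨ solve 3 (λ a w d → a :* d :* (K 1ℚ :- w :- w :* w)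
                                                                  := (K 1ℚ :+ w) :* a :* ((K 1ℚ :- (w :+ w)) :* d) :+ w :* w :* a :* d)
                                                          (λ _ → refl) α w δ ⟩
  (1F ⊕ w) ⊛ α ⊛ ((1F ⊖ (w ⊕ w)) ⊛ δ) ⊕ γ       ≈⟨ +-cong (*-cong α-inverse δ-inverse) (≈-refl {γ}) ⟩
  1F ⊛ 1F ⊕ γ                                   ≈⟨ +-cong (*-identityˡ 1F) (≈-refl {γ}) ⟩
  1F ⊕ γ                                        ∎
  where open ≈-Reasoning

-- Generating functions of the counts

qn≡mkℚ : ∀ n → qn n ≡ mkℚ (ℤ.+ n) 0 (coprime-sym (1-coprimeTo n))
qn≡mkℚ n = ℚ.normalize-coprime _

qn-+ : ∀ m n → qn (m ℕ.+ n) ≡ qn m + qn n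
qn-+ m n rewrite qn≡mkℚ (m ℕ.+ n) | qn≡mkℚ m | qn≡mkℚ n =
  ℚ.toℚᵘ-injective (ℚᵘ.≃-trans (ℚᵘ.*≡* numerators) (ℚᵘ.≃-sym (ℚ.toℚᵘ-homo-+ (ℕ→ℚ m) (ℕ→ℚ n))))
  where
  ℕ→ℚ : ℕ → ℚ
  ℕ→ℚ k = mkℚ (ℤ.+ k) 0 (coprime-sym (1-coprimeTo k))
  numerators : ℤ.+ (m ℕ.+ n) ℤ.* ℤ.+ 1 ≡ (ℤ.+ m ℤ.* ℤ.+ 1 ℤ.+ ℤ.+ n ℤ.* ℤ.+ 1) ℤ.* ℤ.+ 1
  numerators = cong (ℤ._* ℤ.+ 1) (cong₂ ℤ._+_ (sym (ℤ.*-identityʳ (ℤ.+ m))) (sym (ℤ.*-identityʳ (ℤ.+ n))))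

qn-sum-map : ∀ {A : Set} (f : A → ℕ) xs → qn (sum (map f xs)) ≡ sumℚ (map (λ x → qn (f x)) xs)
qn-sum-map f []       = refl
qn-sum-map f (x ∷ xs) = trans (qn-+ (f x) _) (cong (qn (f x) +_) (qn-sum-map f xs))

-- gf j x counts the paths that end at height j with last step x.
gf : ℕ → Step → FPS
gf j       R = γ ⊛ pow v j
gf zero    U = 0F
gf (suc j) U = α ⊛ pow v (suc j)
gf zero    D = 1F ⊕ γ
gf (suc j) D = β ⊛ pow v (suc j)

initial : ℕ → Step → FPS
initial _       U = 0F
initial _       R = 0F
initial zero    D = 1F
initial (suc _) D = 0F

gfSum : List (ℕ × Step) → FPS
gfSum = foldr (λ (j , x) f → gf j x ⊕ f) 0F

gf-system : ∀ j x → gf j x ≈ initial j x ⊕ z ⊛ gfSum (sources j x)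
gf-system j R = begin
  γ ⊛ pow v j                    ≈⟨ *-cong γ-rec (≈-refl {pow v j}) ⟩
  w ⊛ (β ⊕ γ) ⊛ pow v j          ≈⟨ solve 5 (λ x y b g p → (x :* (x :* K 1ℚ) :* y) :* (b :+ g) :* p
                                        := K 0ℚ :+ x :* (b :* (x :* y :* p) :+ (g :* (x :* y :* p) :+ K 0ℚ)))
                                       (λ _ → refl) z t β γ (pow v j) ⟩
  0F ⊕ z ⊛ gfSum (sources j R)   ∎
  where open ≈-Reasoning
gf-system zero U = solve 1 (λ x → K 0ℚ := K 0ℚ :+ x :* K 0ℚ) (λ _ → refl) z
gf-system (suc zero) U = begin
  α ⊛ (v ⊛ 1F)                   ≈⟨ solve 3 (λ a x y → a :* (x :* y :* K 1ℚ) := x :* (a :* y)) (λ _ → refl) α z t ⟩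
  z ⊛ (α ⊛ t)                    ≈⟨ *-cong (≈-refl {z}) α⊛t ⟩
  z ⊛ (1F ⊕ γ)                   ≈⟨ solve 2 (λ x g → x :* (K 1ℚ :+ g) := K 0ℚ :+ x :* (K 0ℚ :+ (K 1ℚ :+ g :+ K 0ℚ))) (λ _ → refl) z γ ⟩
  0F ⊕ z ⊛ gfSum (sources 1 U)   ∎
  where open ≈-Reasoning
gf-system (suc (suc j)) U = begin
  α ⊛ (v ⊛ p)                    ≈⟨ solve 4 (λ a x y p → a :* (x :* y :* p) := x :* (a :* y :* p)) (λ _ → refl) α z t p ⟩
  z ⊛ (α ⊛ t ⊛ p)                ≈⟨ *-cong (≈-refl {z}) (*-cong α⊛t (≈-refl {p})) ⟩
  z ⊛ ((1F ⊕ γ) ⊛ p)             ≈⟨ solve 4 (λ x a g p → x :* ((K 1ℚ :+ g) :* p)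
                                        := K 0ℚ :+ x :* (a :* p :+ ((K 1ℚ :+ g :- a) :* p :+ K 0ℚ))) (λ _ → refl) z α γ p ⟩
  0F ⊕ z ⊛ gfSum (sources (2 ℕ.+ j) U) ∎
  where
  open ≈-Reasoning
  p = pow v (suc j)
gf-system zero D = begin
  1F ⊕ γ                         ≈⟨ +-cong (≈-refl {1F}) γ-rec ⟩
  1F ⊕ w ⊛ (β ⊕ γ)               ≈⟨ solve 4 (λ x y b g → K 1ℚ :+ x :* (x :* K 1ℚ) :* y :* (b :+ g)
                                        := K 1ℚ :+ x :* (b :* (x :* y :* K 1ℚ) :+ (g :* (x :* y :* K 1ℚ) :+ K 0ℚ)))
                                       (λ _ → refl) z t β γ ⟩
  1F ⊕ z ⊛ gfSum (sources 0 D)   ∎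
  where open ≈-Reasoning
gf-system (suc j) D = begin
  β ⊛ (v ⊛ p)                    ≈⟨ *-cong β-rec (≈-refl {v ⊛ p}) ⟩
  w ⊛ (α ⊕ β ⊕ γ) ⊛ (v ⊛ p)      ≈⟨ solve 6 (λ x y a b g p → x :* (x :* K 1ℚ) :* y :* (a :+ b :+ g) :* (x :* y :* p)
                                        := K 0ℚ :+ x :* (a :* (x :* y :* (x :* y :* p))
                                                      :+ (b :* (x :* y :* (x :* y :* p))
                                                      :+ (g :* (x :* y :* (x :* y :* p)) :+ K 0ℚ))))
                                       (λ _ → refl) z t α β γ p ⟩
  0F ⊕ z ⊛ gfSum (sources (suc j) D) ∎
  where
  open ≈-Reasoning
  p = pow v j

gf-total : ∀ j → gfSum (map (j ,_) letters) ≈ c₀ ⊛ pow v j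
gf-total zero    = solve 1 (λ g → K 0ℚ :+ (K 1ℚ :+ g :+ (g :* K 1ℚ :+ K 0ℚ)) := (K 1ℚ :+ g :+ g) :* K 1ℚ) (λ _ → refl) γ
gf-total (suc j) = solve 3 (λ a g p → a :* p :+ ((K 1ℚ :+ g :- a) :* p :+ (g :* p :+ K 0ℚ)) := (K 1ℚ :+ g :+ g) :* p)
                         (λ _ → refl) α γ (pow v (suc j))

gfSum-coeff : ∀ l n → gfSum l n ≡ sumℚ (map (λ (j , x) → gf j x n) l)
gfSum-coeff []            zero    = refl
gfSum-coeff []            (suc n) = refl
gfSum-coeff ((j , x) ∷ l) n       = cong (gf j x n +_) (gfSum-coeff l n)

initial-head : ∀ j x → initial j x 0 ≡ qn (N 0 j x)
initial-head j       U = refl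
initial-head j       R = refl
initial-head zero    D = refl
initial-head (suc j) D = refl

initial-tail : ∀ j x n → initial j x (suc n) ≡ 0ℚ
initial-tail j       U n = refl
initial-tail j       R n = refl
initial-tail zero    D n = refl
initial-tail (suc j) D n = refl

gf-coeff : ∀ n j x → gf j x n ≡ qn (N n j x)
gf-coeff zero j x = begin
  gf j x 0                                        ≡⟨ gf-system j x 0 ⟩
  initial j x 0 + (z ⊛ gfSum (sources j x)) 0     ≡⟨ cong (initial j x 0 +_) (z⊛-zero (gfSum (sources j x))) ⟩
  initial j x 0 + 0ℚ                              ≡⟨ ℚ.+-identityʳ _ ⟩
  initial j x 0                                   ≡⟨ initial-head j x ⟩
  qn (N 0 j x)                                    ∎
  where open ≡-Reasoning
gf-coeff (suc n) j x = begin
  gf j x (suc n)                                            ≡⟨ gf-system j x (suc n) ⟩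
  initial j x (suc n) + (z ⊛ gfSum (sources j x)) (suc n)  ≡⟨ cong₂ _+_ (initial-tail j x n) (z⊛-suc (gfSum (sources j x)) n) ⟩
  0ℚ + gfSum (sources j x) n                                ≡⟨ ℚ.+-identityˡ _ ⟩
  gfSum (sources j x) n                                     ≡⟨ gfSum-coeff (sources j x) n ⟩
  sumℚ (map (λ (j′ , x′) → gf j′ x′ n) (sources j x))       ≡⟨ cong sumℚ (List.map-cong (λ (j′ , x′) → gf-coeff n j′ x′) (sources j x)) ⟩
  sumℚ (map (λ (j′ , x′) → qn (N n j′ x′)) (sources j x))   ≡⟨ qn-sum-map (λ (j′ , x′) → N n j′ x′) (sources j x) ⟨
  qn (sum (map (λ (j′ , x′) → N n j′ x′) (sources j x)))    ≡⟨ cong qn (N-suc n j x) ⟨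
  qn (N (suc n) j x)                                        ∎
  where open ≡-Reasoning

s-closed : ∀ j → s j ≈ c₀ ⊛ pow v j
s-closed j n = begin
  qn (a n j)                                    ≡⟨ cong qn (a≡∑N n j) ⟩
  qn (sum (map (N n j) letters))                ≡⟨ qn-sum-map (N n j) letters ⟩
  sumℚ (map (λ x → qn (N n j x)) letters)       ≡⟨ cong sumℚ (List.map-cong (λ x → gf-coeff n j x) letters) ⟨
  sumℚ (map (λ x → gf j x n) letters)           ≡⟨ gfSum-coeff (map (j ,_) letters) n ⟨
  gfSum (map (j ,_) letters) n                  ≡⟨ gf-total j n ⟩
  (c₀ ⊛ pow v j) n                              ∎
  where open ≡-Reasoning

-- The closed forms of the theorem

g₀-numerator g₀-denominator rhs-numerator : FPS
g₀-numerator   = con 1ℚ ⊖ con (qn 3) ⊛ z² ⊖ con (qn 2) ⊛ z⁴ ⊖ Δ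
g₀-denominator = con (qn 2) ⊛ (z² ⊕ con (qn 3))
rhs-numerator  = z⁴ ⊕ z⁴ ⊛ g₀ ⊕ z² ⊛ g₀ ⊖ z² ⊕ con 1ℚ

g₀-denominator-inverse : g₀-denominator ⊛ inv g₀-denominator ≈ 1F
g₀-denominator-inverse = ⊛-inverseʳ g₀-denominator (λ ())

z²g₀-equation : z² ⊛ g₀ ⊛ g₀-denominator ≈ g₀-numerator
z²g₀-equation = begin
  z² ⊛ (divZ2 g₀-numerator ⊛ i) ⊛ g₀-denominator
    ≈⟨ solve 4 (λ x f i q → x :* (x :* K 1ℚ) :* (f :* i) :* q := x :* (x :* K 1ℚ) :* f :* (q :* i))
               (λ _ → refl) z (divZ2 g₀-numerator) i g₀-denominator ⟩
  z² ⊛ divZ2 g₀-numerator ⊛ (g₀-denominator ⊛ i)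
    ≈⟨ *-cong (z²⊛divZ2 g₀-numerator refl refl) g₀-denominator-inverse ⟩
  g₀-numerator ⊛ 1F
    ≈⟨ *-identityʳ g₀-numerator ⟩
  g₀-numerator ∎
  where
  open ≈-Reasoning
  i = inv g₀-denominator

numerator-in-T : g₀-denominator ⊛ rhs-numerator ≈ con (qn 2) ⊛ (con (qn 4) ⊖ con (qn 2) ⊛ z² ⊖ (1F ⊕ z²) ⊛ T)
numerator-in-T = ≈-modulo (1F ⊕ z²) identity z²g₀-equation
  where
  identity : g₀-denominator ⊛ rhs-numerator
           ≈ con (qn 2) ⊛ (con (qn 4) ⊖ con (qn 2) ⊛ z² ⊖ (1F ⊕ z²) ⊛ T)
             ⊕ (1F ⊕ z²) ⊛ (z² ⊛ g₀ ⊛ g₀-denominator ⊖ g₀-numerator)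
  identity = solve 3 (λ x g d →
      let x² = x :* (x :* K 1ℚ) ; x⁴ = x :* (x :* (x :* (x :* K 1ℚ))) ; q = K (qn 2) :* (x² :+ K (qn 3)) in
      q :* (x⁴ :+ x⁴ :* g :+ x² :* g :- x² :+ K 1ℚ)
        := K (qn 2) :* (K (qn 4) :- K (qn 2) :* x² :- (K 1ℚ :+ x²) :* (K ½ :* (K 1ℚ :+ x² :+ d)))
           :+ (K 1ℚ :+ x²) :* (x² :* g :* q :- (K 1ℚ :- K (qn 3) :* x² :- K (qn 2) :* x⁴ :- d)))
    (λ _ → refl) z g₀ Δ

rhs-numerator⊛t : rhs-numerator ⊛ t ≈ c₀
rhs-numerator⊛t = begin
  B ⊛ t                                   ≈⟨ solve 4 (λ b y u a → b :* y := b :* y :* u :* a :+ b :* y :* (K 1ℚ :- u :* a))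
                                                     (λ _ → refl) B t (1F ⊕ w) α ⟩
  B ⊛ t ⊛ (1F ⊕ w) ⊛ α ⊕ B ⊛ t ⊛ (1F ⊖ (1F ⊕ w) ⊛ α)
                                          ≈⟨ +-cong (*-cong scaled (≈-refl {α}))
                                                    (*-cong (≈-refl {B ⊛ t}) (+-cong (≈-refl {1F}) (-‿cong α-inverse))) ⟩
  (t ⊕ t ⊖ (1F ⊕ w)) ⊛ α ⊕ B ⊛ t ⊛ (1F ⊖ 1F)
                                          ≈⟨ solve 4 (λ b y u a → (y :+ y :- u) :* a :+ b :* y :* (K 1ℚ :- K 1ℚ)
                                                              := a :* y :+ a :* y :- u :* a) (λ _ → refl) B t (1F ⊕ w) α ⟩
  α ⊛ t ⊕ α ⊛ t ⊖ (1F ⊕ w) ⊛ α           ≈⟨ +-cong (+-cong α⊛t α⊛t) (-‿cong α-inverse) ⟩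
  (1F ⊕ γ) ⊕ (1F ⊕ γ) ⊖ 1F                ≈⟨ solve 1 (λ g → (K 1ℚ :+ g) :+ (K 1ℚ :+ g) :- K 1ℚ := K 1ℚ :+ g :+ g) (λ _ → refl) γ ⟩
  c₀                                      ∎
  where
  open ≈-Reasoning
  B = rhs-numerator
  scaled : B ⊛ t ⊛ (1F ⊕ w) ≈ t ⊕ t ⊖ (1F ⊕ w)
  scaled = ⊛-cancelʳ {u = g₀-denominator} {u′ = inv g₀-denominator} g₀-denominator-inverse (begin
    B ⊛ t ⊛ (1F ⊕ w) ⊛ g₀-denominator
      ≈⟨ solve 4 (λ b y u q → b :* y :* u :* q := q :* b :* (y :* u)) (λ _ → refl) B t (1F ⊕ w) g₀-denominator ⟩
    g₀-denominator ⊛ B ⊛ (t ⊛ (1F ⊕ w))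
      ≈⟨ *-cong numerator-in-T (≈-refl {t ⊛ (1F ⊕ w)}) ⟩
    con (qn 2) ⊛ (con (qn 4) ⊖ con (qn 2) ⊛ z² ⊖ (1F ⊕ z²) ⊛ T) ⊛ (t ⊛ (1F ⊕ w))
      ≈⟨ ≈-modulo (neg (con (qn 4))) (≈-modulo (neg (con (qn 2) ⊛ (1F ⊕ z²) ⊛ (1F ⊕ w))) identity T-inverse) t-quadratic ⟩
    (t ⊕ t ⊖ (1F ⊕ w)) ⊛ g₀-denominator ∎)
    where
    identity : con (qn 2) ⊛ (con (qn 4) ⊖ con (qn 2) ⊛ z² ⊖ (1F ⊕ z²) ⊛ T) ⊛ (t ⊛ (1F ⊕ w))
             ≈ (t ⊕ t ⊖ (1F ⊕ w)) ⊛ g₀-denominator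
               ⊕ neg (con (qn 4)) ⊛ (t ⊛ (1F ⊖ (w ⊕ w)) ⊖ (1F ⊖ w ⊖ w ⊛ w))
               ⊕ neg (con (qn 2) ⊛ (1F ⊕ z²) ⊛ (1F ⊕ w)) ⊛ (T ⊛ t ⊖ 1F)
    identity = solve 3 (λ x y τ →
        let x² = x :* (x :* K 1ℚ) ; u = x² :* y in
        K (qn 2) :* (K (qn 4) :- K (qn 2) :* x² :- (K 1ℚ :+ x²) :* τ) :* (y :* (K 1ℚ :+ u))
          := (y :+ y :- (K 1ℚ :+ u)) :* (K (qn 2) :* (x² :+ K (qn 3)))
             :+ :- K (qn 4) :* (y :* (K 1ℚ :- (u :+ u)) :- (K 1ℚ :- u :- u :* u))
             :+ :- (K (qn 2) :* (K 1ℚ :+ x²) :* (K 1ℚ :+ u)) :* (τ :* y :- K 1ℚ))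
      (λ _ → refl) z t T

rhs₁-explicit : ∀ j → rhs₁ j ≈ pow z j ⊛ rhs-numerator ⊛ pow t (suc j)
rhs₁-explicit j = *-cong (≈-refl {pow z j ⊛ rhs-numerator})
                         (inv-unique (pow T (suc j)) (pow t (suc j)) (pow-inverse T t (suc j) T-inverse))

rhs₁-closed : ∀ j → rhs₁ j ≈ c₀ ⊛ pow v j
rhs₁-closed j = begin
  rhs₁ j                                            ≈⟨ rhs₁-explicit j ⟩
  pow z j ⊛ B ⊛ (t ⊛ pow t j)                       ≈⟨ solve 4 (λ p b y q → p :* b :* (y :* q) := b :* y :* (p :* q))
                                                               (λ _ → refl) (pow z j) B t (pow t j) ⟩
  B ⊛ t ⊛ (pow z j ⊛ pow t j)                       ≈⟨ *-cong rhs-numerator⊛t (≈-sym (pow-distrib-⊛ z t j)) ⟩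
  c₀ ⊛ pow v j                                      ∎
  where
  open ≈-Reasoning
  B = rhs-numerator

con-2^k⊛½^k : ∀ k → con (qn (2 ℕ.^ k)) ⊛ pow (con ½) k ≈ 1F
con-2^k⊛½^k zero    = ⊛-identityˡ 1F
con-2^k⊛½^k (suc k) = begin
  con (qn (m ℕ.+ (m ℕ.+ 0))) ⊛ (con ½ ⊛ pow (con ½) k)   ≈⟨ *-cong doubled (≈-refl {con ½ ⊛ pow (con ½) k}) ⟩
  (con (qn m) ⊕ con (qn m)) ⊛ (con ½ ⊛ pow (con ½) k)    ≈⟨ solve 2 (λ c h → (c :+ c) :* (K ½ :* h) := c :* h) (λ _ → refl) (con (qn m)) (pow (con ½) k) ⟩
  con (qn m) ⊛ pow (con ½) k                              ≈⟨ con-2^k⊛½^k k ⟩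
  1F                                                      ∎
  where
  open ≈-Reasoning
  m = 2 ℕ.^ k
  doubled : con (qn (m ℕ.+ (m ℕ.+ 0))) ≈ con (qn m) ⊕ con (qn m)
  doubled n = trans (cong (λ q → con q n) (trans (qn-+ m (m ℕ.+ 0)) (cong (qn m +_) (trans (qn-+ m 0) (ℚ.+-identityʳ (qn m))))))
                    (con-+ (qn m) (qn m) n)

rhs-explicit : ∀ j → rhs j ≈ pow z j ⊛ rhs-numerator ⊛ pow t (suc j)
rhs-explicit j = begin
  c ⊛ pow z j ⊛ B′ ⊛ inv (pow X k)            ≈⟨ *-cong (≈-refl {c ⊛ pow z j ⊛ B′}) inv-pow-X ⟩
  c ⊛ pow z j ⊛ B′ ⊛ (pow (con ½) k ⊛ pow t k) ≈⟨ solve 5 (λ c p b h q → c :* p :* b :* (h :* q) := c :* h :* (p :* b :* q))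
                                                        (λ _ → refl) c (pow z j) B′ (pow (con ½) k) (pow t k) ⟩
  c ⊛ pow (con ½) k ⊛ (pow z j ⊛ B′ ⊛ pow t k) ≈⟨ *-cong (con-2^k⊛½^k k) (*-cong (*-cong (≈-refl {pow z j}) B′≈B) (≈-refl {pow t k})) ⟩
  1F ⊛ (pow z j ⊛ B ⊛ pow t k)                 ≈⟨ *-identityˡ (pow z j ⊛ B ⊛ pow t k) ⟩
  pow z j ⊛ B ⊛ pow t k                        ∎
  where
  open ≈-Reasoning
  k = suc j
  c = con (qn (2 ℕ.^ k))
  X = con 1ℚ ⊕ z² ⊕ Δ
  B = rhs-numerator
  B′ = con 1ℚ ⊖ z² ⊕ z⁴ ⊕ (z² ⊕ z⁴) ⊛ g₀
  B′≈B : B′ ≈ B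
  B′≈B = solve 2 (λ x g → let x² = x :* (x :* K 1ℚ) ; x⁴ = x :* (x :* (x :* (x :* K 1ℚ))) in
                   K 1ℚ :- x² :+ x⁴ :+ (x² :+ x⁴) :* g := x⁴ :+ x⁴ :* g :+ x² :* g :- x² :+ K 1ℚ)
                 (λ _ → refl) z g₀
  X⊛half-t : X ⊛ (con ½ ⊛ t) ≈ 1F
  X⊛half-t = ≈-trans (solve 2 (λ x y → x :* (K ½ :* y) := K ½ :* x :* y) (λ _ → refl) X t) T-inverse
  inv-pow-X : inv (pow X k) ≈ pow (con ½) k ⊛ pow t k
  inv-pow-X = inv-unique (pow X k) (pow (con ½) k ⊛ pow t k)
    (≈-trans (*-cong (≈-refl {pow X k}) (≈-sym (pow-distrib-⊛ (con ½) t k))) (pow-inverse X (con ½ ⊛ t) k X⊛half-t))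

mainTheorem3 : ∀ (j n : ℕ) → (s j n ≡ rhs₁ j n) × (rhs₁ j n ≡ rhs j n)
mainTheorem3 j n = trans (s-closed j n) (sym (rhs₁-closed j n))
                 , trans (rhs₁-explicit j n) (sym (rhs-explicit j n))
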